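{- Let $G$ be a connected graph and $H$ a connected subgraph of $G$ with at least two vertices. Suppose $v\in\partial H$ and $u$ is a witness for $v\in\partial H$. If $N_H(v)=N_G(v)$ and $d_H(v,u)=d_G(v,u)$, then $v\in\partial G$.
   Context: Graphs are finite, simple, undirected; $d_K$, $N_K$, $\deg_K$ denote distance, neighbourhood and degree in a graph $K$. For a connected graph $K=(V,E)$, the Steinerberger boundary is $\partial K=\{v\in V:\ \exists u\in V \text{ with } \frac{1}{\deg_K(v)}\sum_{w\in N_K(v)} d_K(w,u)<d_K(v,u)\}$ (with $\partial K=V$ if $|V|=1$); any such $u$ is called a witness for $v\in\partial K$. -}

module Defs where

open import Data.Nat using (ℕ; zero; suc; _+_; _*_; _<_; _≤_)
open import Data.Bool using (Bool; true; false; _∧_; _∨_; T; if_then_else_)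
open import Data.Fin using (Fin)
open import Data.Fin.Properties using (_≟_)
open import Data.List using (List; []; _∷_; map; foldr)
open import Data.Nat.ListAction using (sum)
open import Data.List using (allFin)
open import Data.Product using (Σ; ∃; _×_)
open import Data.Sum using (_⊎_)
open import Relation.Nullary.Decidable using (⌊_⌋)
open import Relation.Binary.PropositionalEquality using (_≡_)
open import Function.Definitions using (Injective)

record Graph (n : ℕ) : Set where
  field
    adj   : Fin n → Fin n → Bool
    sym   : ∀ x y → adj x y ≡ adj y x
    irrfl : ∀ x → adj x x ≡ false
open Graph public

Σv : ∀ {n} → (Fin n → ℕ) → ℕ
Σv {n} f = sum (map f (allFin n))

anyv : ∀ {n} → (Fin n → Bool) → Bool
anyv {n} p = foldr _∨_ false (map p (allFin n))

walk? : ∀ {n} → Graph n → ℕ → Fin n → Fin n → Bool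
walk? K zero    x y = ⌊ x ≟ y ⌋
walk? K (suc k) x y = anyv (λ w → adj K x w ∧ walk? K k w y)

Connected : ∀ {n} → Graph n → Set
Connected K = ∀ x y → ∃ λ k → T (walk? K k x y)

firstWalk : ∀ {n} → Graph n → Fin n → Fin n → ℕ → ℕ → ℕ
firstWalk K x y i zero       = i
firstWalk K x y i (suc fuel) = if walk? K i x y then i else firstWalk K x y (suc i) fuel

-- Shortest walks have length < n, so searching 0..n-1 suffices;
-- the default value n for unreachable pairs is never used for connected K.
dist : ∀ {n} → Graph n → Fin n → Fin n → ℕ
dist {n} K x y = firstWalk K x y 0 n

deg : ∀ {n} → Graph n → Fin n → ℕ
deg K v = Σv (λ w → if adj K v w then 1 else 0)

nbrDistSum : ∀ {n} → Graph n → Fin n → Fin n → ℕ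
nbrDistSum K v u = Σv (λ w → if adj K v w then dist K w u else 0)

-- u is a witness for v ∈ ∂K :  (1/deg v) Σ_{w∈N(v)} d(w,u) < d(v,u),
-- written with the (positive) degree multiplied out.
Witness : ∀ {n} → Graph n → Fin n → Fin n → Set
Witness K v u = nbrDistSum K v u < deg K v * dist K v u

InBoundary : ∀ {n} → Graph n → Fin n → Set
InBoundary {n} K v = n ≡ 1 ⊎ ∃ λ u → Witness K v u

IsSubgraph : ∀ {m n} → Graph m → Graph n → (Fin m → Fin n) → Set
IsSubgraph H G f = Injective _≡_ _≡_ f × (∀ a b → T (adj H a b) → T (adj G (f a) (f b)))

SameNbhd : ∀ {m n} → Graph m → Graph n → (Fin m → Fin n) → Fin m → Set
SameNbhd H G f v = ∀ x → (T (adj G (f v) x) → ∃ λ w → f w ≡ x × T (adj H v w))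
                       × (∀ w → T (adj H v w) → T (adj G (f v) (f w)))

{-# OPTIONS --safe #-}
-- The injection f matches N_H(v) with N_G(f v), so deg_G(f v) = deg_H(v), and since walks of H
-- map to walks of G, d_G(f w, f u) ≤ d_H(w, u) for every neighbour w of v. Hence
--   Σ_{x ∈ N_G(f v)} d_G(x, f u) ≤ Σ_{w ∈ N_H(v)} d_H(w, u) < deg_H(v) d_H(v, u) = deg_G(f v) d_G(f v, f u),
-- i.e. f u witnesses f v ∈ ∂G.
module Submission where

open import Defs hiding (sym)
open import Data.Nat using (ℕ; zero; suc; _+_; _*_; _≤_; _<_; z≤n)
open import Data.Nat.Properties
  using (+-0-commutativeMonoid; +-identityʳ; +-mono-≤; m≤n⇒m<n∨m≡n; <⇒≱; +-suc; module ≤-Reasoning)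
open import Data.Nat.ListAction using (sum)
open import Data.Fin using (Fin; zero; suc; punchIn)
open import Data.Fin.Properties using (_≟_; punchInᵢ≢i; injective⇒≤)
open import Data.Bool using (Bool; true; false; _∧_; T; if_then_else_)
open import Data.Bool.Properties using (T-∧; T-≡; if-cong)
open import Data.List using (List; []; _∷_; length; lookup; tabulate; allFin)
open import Data.List.Properties using (map-tabulate)
open import Data.List.Relation.Unary.All using ([]; _∷_) renaming (lookup to All-lookup)
open import Data.List.Relation.Unary.All.Properties using (¬Any⇒All¬)
open import Data.List.Relation.Unary.Any using (here; there; any?; satisfied)
open import Data.List.Relation.Unary.Any.Properties using (any⁺; any⁻)
open import Data.List.Relation.Unary.AllPairs using ([]; _∷_)
open import Data.List.Relation.Unary.Unique.Propositional using (Unique)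
open import Data.List.Membership.Propositional using (_∈_; lose)
open import Data.List.Membership.Propositional.Properties using (∈-allFin; ∈-lookup)
open import Data.Product using (∃; ∃₂; _×_; _,_; proj₁; proj₂)
open import Data.Sum using (inj₁; inj₂)
open import Data.Empty using (⊥-elim)
open import Function using (_∘_; id)
open import Function.Bundles using (Equivalence)
open import Function.Definitions using (Injective)
open import Relation.Nullary using (¬_; yes; no; contradiction)
open import Relation.Nullary.Decidable using (⌊_⌋; toWitness; fromWitness)
open import Relation.Binary.PropositionalEquality
  using (_≡_; _≢_; refl; sym; trans; cong; cong₂; subst; module ≡-Reasoning)
open import Algebra.Properties.CommutativeMonoid.Sum +-0-commutativeMonoid
  using (sum-cong-≗; sum-replicate-zero; sum-remove; ∑-comm)
  renaming (sum to ∑)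

open Equivalence using (to; from)

sum-tabulate : ∀ {n} (g : Fin n → ℕ) → sum (tabulate g) ≡ ∑ g
sum-tabulate {zero}  g = refl
sum-tabulate {suc n} g = cong (g zero +_) (sum-tabulate (g ∘ suc))

Σv≡∑ : ∀ {n} (g : Fin n → ℕ) → Σv g ≡ ∑ g
Σv≡∑ g = trans (cong sum (map-tabulate id g)) (sum-tabulate g)

∑-mono-≤ : ∀ {n} {g h : Fin n → ℕ} → (∀ i → g i ≤ h i) → ∑ g ≤ ∑ h
∑-mono-≤ {zero}  g≤h = z≤n
∑-mono-≤ {suc n} g≤h = +-mono-≤ (g≤h zero) (∑-mono-≤ (g≤h ∘ suc))

∑-zero : ∀ {n} {t : Fin n → ℕ} → (∀ i → t i ≡ 0) → ∑ t ≡ 0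
∑-zero {n} t≡0 = trans (sum-cong-≗ t≡0) (sum-replicate-zero n)

∑-single : ∀ {n} (t : Fin n → ℕ) (i : Fin n) → (∀ j → j ≢ i → t j ≡ 0) → ∑ t ≡ t i
∑-single {suc n} t i t≡0 = begin
  ∑ t                             ≡⟨ sum-remove t ⟩
  t i + ∑ (t ∘ punchIn i)         ≡⟨ cong (t i +_) (∑-zero (λ j → t≡0 _ (punchInᵢ≢i i j))) ⟩
  t i + 0                         ≡⟨ +-identityʳ (t i) ⟩
  t i                             ∎
  where open ≡-Reasoning

∑-select : ∀ {n} (i : Fin n) (t : Fin n → ℕ) → ∑ (λ j → if ⌊ i ≟ j ⌋ then t j else 0) ≡ t i
∑-select i t = trans (∑-single _ i off-i) on-i
  where
  off-i : ∀ j → j ≢ i → (if ⌊ i ≟ j ⌋ then t j else 0) ≡ 0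
  off-i j j≢i with i ≟ j
  ... | yes i≡j = contradiction (sym i≡j) j≢i
  ... | no _    = refl
  on-i : (if ⌊ i ≟ i ⌋ then t i else 0) ≡ t i
  on-i with i ≟ i
  ... | yes _  = refl
  ... | no i≢i = contradiction refl i≢i

∑-reindex : ∀ {m n} (f : Fin m → Fin n) → Injective _≡_ _≡_ f
  → (a : Fin n → Bool) (b : Fin m → Bool)
  → (∀ x → T (a x) → ∃ λ w → f w ≡ x × T (b w))
  → (∀ w → T (b w) → T (a (f w)))
  → (F : Fin n → ℕ)
  → ∑ (λ x → if a x then F x else 0) ≡ ∑ (λ w → if b w then F (f w) else 0)
∑-reindex {m} {n} f f-inj a b onto into F = begin
  ∑ (λ x → if a x then F x else 0)      ≡⟨ sum-cong-≗ (λ x → column x (a x) refl) ⟨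
  ∑ (λ x → ∑ (λ w → K w x))             ≡⟨ ∑-comm K ⟨
  ∑ (λ w → ∑ (K w))                     ≡⟨ sum-cong-≗ (λ w → ∑-select (f w) (bF w)) ⟩
  ∑ (λ w → if b w then F (f w) else 0)  ∎
  where
  open ≡-Reasoning
  bF : Fin m → Fin n → ℕ
  bF w x = if b w then F x else 0
  K : Fin m → Fin n → ℕ
  K w x = if ⌊ f w ≟ x ⌋ then bF w x else 0
  K-off : ∀ {w} w′ → w′ ≢ w → K w′ (f w) ≡ 0
  K-off {w} w′ w′≢w with f w′ ≟ f w
  ... | yes fw′≡fw = contradiction (f-inj fw′≡fw) w′≢w
  ... | no _       = refl
  K-on : ∀ w → T (b w) → K w (f w) ≡ F (f w)
  K-on w bw with f w ≟ f w
  ... | yes _    = if-cong (to T-≡ bw)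
  ... | no fw≢fw = contradiction refl fw≢fw
  K-outside : ∀ {x} → ¬ T (a x) → ∀ w → K w x ≡ 0
  K-outside {x} ¬ax w with f w ≟ x | b w in bw
  ... | yes refl | true  = contradiction (into w (from T-≡ bw)) ¬ax
  ... | yes refl | false = refl
  ... | no _     | _     = refl
  column : ∀ x c → a x ≡ c → ∑ (λ w → K w x) ≡ (if c then F x else 0)
  column x true  ax with onto x (from T-≡ ax)
  ... | w , refl , bw = trans (∑-single (λ w′ → K w′ (f w)) w K-off) (K-on w bw)
  column x false ax = ∑-zero (K-outside (subst T ax))

data Walk {n} (K : Graph n) : Fin n → Fin n → ℕ → Set where
  []  : ∀ {x} → Walk K x x 0
  _∷_ : ∀ {x w y k} → T (adj K x w) → Walk K w y k → Walk K x y (suc k)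

walk?-sound : ∀ {n} (K : Graph n) k x y → T (walk? K k x y) → Walk K x y k
walk?-sound K zero    x y t with toWitness t
... | refl = []
walk?-sound K (suc k) x y t with satisfied (any⁻ _ (allFin _) t)
... | w , xw∧wy with to T-∧ xw∧wy
...   | xw , wy = xw ∷ walk?-sound K k w y wy

walk?-complete : ∀ {n} (K : Graph n) {k x y} → Walk K x y k → T (walk? K k x y)
walk?-complete K {x = x} [] = fromWitness {a? = x ≟ x} refl
walk?-complete K (_∷_ {w = w} xw r) = any⁺ _ (lose (∈-allFin w) (from T-∧ (xw , walk?-complete K r)))

vertices : ∀ {n} {K : Graph n} {x y k} → Walk K x y k → List (Fin n)
vertices {x = x} []       = x ∷ []
vertices {x = x} (_ ∷ r)  = x ∷ vertices r

length-vertices : ∀ {n} {K : Graph n} {x y k} (r : Walk K x y k) → length (vertices r) ≡ suc k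
length-vertices []      = refl
length-vertices (_ ∷ r) = cong suc (length-vertices r)

Path : ∀ {n} → Graph n → Fin n → Fin n → Set
Path K x y = ∃₂ λ k (r : Walk K x y k) → Unique (vertices r)

suffix : ∀ {n} {K : Graph n} {x w y k} (r : Walk K w y k) → Unique (vertices r) → x ∈ vertices r → Path K x y
suffix []      u        (here refl) = _ , [] , u
suffix (e ∷ r) u        (here refl) = _ , e ∷ r , u
suffix (_ ∷ r) (_ ∷ u)  (there x∈r) = suffix r u x∈r

-- Loop erasure: if x already lies on the path obtained from the tail, the loop through x is cut off.
walk⇒path : ∀ {n} {K : Graph n} {x y k} → Walk K x y k → Path K x y
walk⇒path []                  = 0 , [] , [] ∷ []
walk⇒path {x = x} (xw ∷ r) with walk⇒path r
... | k , p , p-unique with any? (x ≟_) (vertices p)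
...   | yes x∈p = suffix p p-unique x∈p
...   | no  x∉p = suc k , xw ∷ p , ¬Any⇒All¬ (vertices p) x∉p ∷ p-unique

lookup-injective : ∀ {A : Set} (xs : List A) → Unique xs → Injective _≡_ _≡_ (lookup xs)
lookup-injective (_ ∷ _)  _        {zero}  {zero}  _  = refl
lookup-injective (_ ∷ _)  (x∉ ∷ _) {zero}  {suc j} eq = contradiction eq (All-lookup x∉ (∈-lookup j))
lookup-injective (_ ∷ _)  (x∉ ∷ _) {suc i} {zero}  eq = contradiction (sym eq) (All-lookup x∉ (∈-lookup i))
lookup-injective (_ ∷ xs) (_ ∷ u)  {suc i} {suc j} eq = cong suc (lookup-injective xs u eq)

Unique⇒length≤ : ∀ {n} (xs : List (Fin n)) → Unique xs → length xs ≤ n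
Unique⇒length≤ xs u = injective⇒≤ (lookup-injective xs u)

walk⇒shortWalk : ∀ {n} {K : Graph n} {x y k} → Walk K x y k → ∃ λ k′ → k′ < n × Walk K x y k′
walk⇒shortWalk r with walk⇒path r
... | k , p , p-unique = k , subst (_≤ _) (length-vertices p) (Unique⇒length≤ (vertices p) p-unique) , p

Homomorphism : ∀ {m n} → Graph m → Graph n → (Fin m → Fin n) → Set
Homomorphism H G f = ∀ a b → T (adj H a b) → T (adj G (f a) (f b))

map-walk : ∀ {m n} {H : Graph m} {G : Graph n} {f : Fin m → Fin n} → Homomorphism H G f
  → ∀ {a b k} → Walk H a b k → Walk G (f a) (f b) k
map-walk hom []       = []
map-walk hom (ab ∷ r) = hom _ _ ab ∷ map-walk hom r

firstWalk-≤ : ∀ {n} (K : Graph n) x y i fuel {k} → i ≤ k → T (walk? K k x y) → firstWalk K x y i fuel ≤ k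
firstWalk-≤ K x y i zero       i≤k _ = i≤k
firstWalk-≤ K x y i (suc fuel) i≤k t with walk? K i x y in walk-i | m≤n⇒m<n∨m≡n i≤k
... | true  | _        = i≤k
... | false | inj₁ i<k = firstWalk-≤ K x y (suc i) fuel i<k t
... | false | inj₂ refl = ⊥-elim (subst T walk-i t)

firstWalk-walk : ∀ {n} (K : Graph n) x y i fuel {k} → i ≤ k → k < i + fuel → T (walk? K k x y)
  → T (walk? K (firstWalk K x y i fuel) x y)
firstWalk-walk K x y i zero       i≤k k<i+0 _ = contradiction (subst (_≤ _) (sym (+-identityʳ i)) i≤k) (<⇒≱ k<i+0)
firstWalk-walk K x y i (suc fuel) {k} i≤k k<i+fuel t with walk? K i x y in walk-i | m≤n⇒m<n∨m≡n i≤k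
... | true  | _        = from T-≡ walk-i
... | false | inj₁ i<k = firstWalk-walk K x y (suc i) fuel i<k (subst (k <_) (+-suc i fuel) k<i+fuel) t
... | false | inj₂ refl = ⊥-elim (subst T walk-i t)

dist-≤ : ∀ {n} (K : Graph n) {x y k} → Walk K x y k → dist K x y ≤ k
dist-≤ {n} K {x} {y} r = firstWalk-≤ K x y 0 n z≤n (walk?-complete K r)

dist-walk : ∀ {n} (K : Graph n) → Connected K → ∀ x y → Walk K x y (dist K x y)
dist-walk {n} K K-connected x y with K-connected x y
... | k , t with walk⇒shortWalk (walk?-sound K k x y t)
...   | k′ , k′<n , r = walk?-sound K _ x y (firstWalk-walk K x y 0 n z≤n k′<n (walk?-complete K r))

dist-homomorphism-≤ : ∀ {m n} (H : Graph m) (G : Graph n) {f : Fin m → Fin n}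
  → Connected H → Homomorphism H G f → ∀ a b → dist G (f a) (f b) ≤ dist H a b
dist-homomorphism-≤ H G H-connected hom a b = dist-≤ G (map-walk hom (dist-walk H H-connected a b))

Σv-SameNbhd : ∀ {m n} (H : Graph m) (G : Graph n) {f : Fin m → Fin n} → Injective _≡_ _≡_ f
  → ∀ v → SameNbhd H G f v → (F : Fin n → ℕ)
  → Σv (λ x → if adj G (f v) x then F x else 0) ≡ Σv (λ w → if adj H v w then F (f w) else 0)
Σv-SameNbhd H G {f} f-inj v same F = begin
  Σv inG  ≡⟨ Σv≡∑ inG ⟩
  ∑ inG   ≡⟨ ∑-reindex f f-inj _ _ (proj₁ ∘ same) (proj₂ (same (f v))) F ⟩
  ∑ inH   ≡⟨ Σv≡∑ inH ⟨
  Σv inH  ∎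
  where
  open ≡-Reasoning
  inG : Fin _ → ℕ
  inG x = if adj G (f v) x then F x else 0
  inH : Fin _ → ℕ
  inH w = if adj H v w then F (f w) else 0

deg-SameNbhd : ∀ {m n} (H : Graph m) (G : Graph n) {f : Fin m → Fin n} → Injective _≡_ _≡_ f
  → ∀ v → SameNbhd H G f v → deg G (f v) ≡ deg H v
deg-SameNbhd H G f-inj v same = Σv-SameNbhd H G f-inj v same (λ _ → 1)

nbrDistSum-SameNbhd-≤ : ∀ {m n} (H : Graph m) (G : Graph n) {f : Fin m → Fin n}
  → Connected H → Homomorphism H G f → Injective _≡_ _≡_ f
  → ∀ v → SameNbhd H G f v → ∀ u → nbrDistSum G (f v) (f u) ≤ nbrDistSum H v u
nbrDistSum-SameNbhd-≤ H G {f} H-connected hom f-inj v same u = begin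
  nbrDistSum G (f v) (f u)  ≡⟨ Σv-SameNbhd H G f-inj v same (λ x → dist G x (f u)) ⟩
  Σv distG                  ≡⟨ Σv≡∑ distG ⟩
  ∑ distG                   ≤⟨ ∑-mono-≤ (λ w → termwise (adj H v w) w) ⟩
  ∑ distH                   ≡⟨ Σv≡∑ distH ⟨
  nbrDistSum H v u          ∎
  where
  open ≤-Reasoning
  distG : Fin _ → ℕ
  distG w = if adj H v w then dist G (f w) (f u) else 0
  distH : Fin _ → ℕ
  distH w = if adj H v w then dist H w u else 0
  termwise : ∀ c w → (if c then dist G (f w) (f u) else 0) ≤ (if c then dist H w u else 0)
  termwise true  w = dist-homomorphism-≤ H G H-connected hom w u
  termwise false w = z≤n

lemma3p8 : ∀ {m n} (G : Graph n) (H : Graph m) (f : Fin m → Fin n)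
    → Connected G → Connected H → IsSubgraph H G f → 2 ≤ m
    → (v u : Fin m) → Witness H v u
    → SameNbhd H G f v → dist H v u ≡ dist G (f v) (f u)
    → InBoundary G (f v)
lemma3p8 G H f _ H-connected (f-inj , f-hom) _ v u witness same dist-eq = inj₂ (f u , (begin-strict
  nbrDistSum G (f v) (f u)          ≤⟨ nbrDistSum-SameNbhd-≤ H G H-connected f-hom f-inj v same u ⟩
  nbrDistSum H v u                  <⟨ witness ⟩
  deg H v * dist H v u              ≡⟨ cong₂ _*_ (sym (deg-SameNbhd H G f-inj v same)) dist-eq ⟩
  deg G (f v) * dist G (f v) (f u)  ∎))
  where open ≤-Reasoning
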